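{- For $n\ge5$, the string $p_{n-1}$ (which is a border of $p_n$) is the longest proper cover of $p_n$.
   Context: Fibonacci words are defined by $f_0=0$, $f_1=1$, $f_n=f_{n-1}f_{n-2}$ for $n\ge2$, with $F_n=|f_n|$. For $n\ge2$, $p_n=f_n[1..F_n-2]$ denotes $f_n$ with its last two symbols removed. A cover of a string $x$ is a substring $u$ of $x$ such that $x$ can be constructed by overlapping and/or adjacent occurrences of $u$ (i.e., every position of $x$ lies in some occurrence of $u$ in $x$); it is proper if $|u|<|x|$. A border of $x$ is a nonempty string that is both a proper prefix and a proper suffix of $x$. -}

module Defs where

open import Data.Bool using (Bool; true; false)
open import Data.List using (List; []; _∷_; _++_; length; take; drop)
open import Data.Nat using (ℕ; zero; suc; _+_; _∸_; _≤_; _<_)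
open import Data.Product using (Σ; ∃; _×_; _,_)
open import Relation.Binary.PropositionalEquality using (_≡_)

-- Strings over the binary alphabet {0,1}; the symbol 0 is false, 1 is true.
Str : Set
Str = List Bool

fib : ℕ → Str
fib zero = false ∷ []
fib (suc zero) = true ∷ []
fib (suc (suc n)) = fib (suc n) ++ fib n

F : ℕ → ℕ
F n = length (fib n)

-- p n = f n with its last two symbols removed (meaningful for n ≥ 2).
p : ℕ → Str
p n = take (F n ∸ 2) (fib n)

OccursAt : Str → Str → ℕ → Set
OccursAt u x j = j + length u ≤ length x × take (length u) (drop j x) ≡ u

Substring : Str → Str → Set
Substring u x = ∃ λ j → OccursAt u x j

Cover : Str → Str → Set
Cover u x = Substring u x ×
  ((i : ℕ) → i < length x → ∃ λ j → OccursAt u x j × j ≤ i × i < j + length u)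

ProperCover : Str → Str → Set
ProperCover u x = Cover u x × length u < length x

Border : Str → Str → Set
Border u x = 0 < length u × length u < length x ×
  (∃ λ v → u ++ v ≡ x) × (∃ λ w → w ++ u ≡ x)

-- A cover u of a nonempty x must occur both at the first and the last position of x,
-- so u is a border and |x| − |u| is a period of x.  Hence a proper cover of p_n longer
-- than p_{n-1} yields a period q of p_n with 0 < q < F_{n-2}, and no such period exists:
-- since p_{n+1} = f_{n-1} p_n and p_n is a prefix of p_{n+1}, the word p_{n+1} has period
-- F_{n-1}; a period q of p_{n+1} with F_{n-2} ≤ q < F_{n-1} then makes F_{n-1} − q ≤ F_{n-3}
-- a period of p_n, while a smaller q is already a period of the prefix p_n.  Induction
-- from the direct check of p_5 = 101101 finishes the argument.
module Submission where

open import Defs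
open import Data.Bool using (Bool; false)
open import Data.Empty using (⊥-elim)
open import Data.List using ([]; _∷_; _++_; length; take; drop)
open import Data.List.Properties
  using (length-++; length-drop; take-all; take++drop≡id; ++-assoc)
open import Data.Nat using (ℕ; zero; suc; _+_; _∸_; _≤_; _<_; z≤n; s≤s; _<?_; _≤?_)
open import Data.Nat.Properties
open import Data.Product using (∃; _×_; _,_)
open import Relation.Nullary using (¬_; yes; no)
open import Relation.Binary.PropositionalEquality

-- Out-of-range positions read as false; every use below is guarded by a bound.
at : Str → ℕ → Bool
at [] _ = false
at (c ∷ cs) zero = c
at (c ∷ cs) (suc i) = at cs i

at-++ˡ : ∀ xs ys {i} → i < length xs → at (xs ++ ys) i ≡ at xs i
at-++ˡ (c ∷ cs) ys {zero} _ = refl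
at-++ˡ (c ∷ cs) ys {suc i} (s≤s i<cs) = at-++ˡ cs ys i<cs

at-++ʳ : ∀ xs ys i → at (xs ++ ys) (length xs + i) ≡ at ys i
at-++ʳ [] ys i = refl
at-++ʳ (c ∷ cs) ys i = at-++ʳ cs ys i

Period : ℕ → Str → Set
Period q w = ∀ i → i + q < length w → at w i ≡ at w (i + q)

m+n≡o+q⇒q<n⇒m<o : ∀ {m n o q} → m + n ≡ o + q → q < n → m < o
m+n≡o+q⇒q<n⇒m<o {m} {n} {o} {q} eq q<n = +-cancelʳ-≤ q (suc m) o (begin
  suc m + q ≡⟨ +-suc m q ⟨
  m + suc q ≤⟨ +-monoʳ-≤ m q<n ⟩
  m + n     ≡⟨ eq ⟩
  o + q     ∎)
  where open ≤-Reasoning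

length-≤-++ : ∀ (xs ys : Str) → length xs ≤ length (xs ++ ys)
length-≤-++ xs ys = subst (length xs ≤_) (sym (length-++ xs)) (m≤m+n (length xs) (length ys))

period-++ˡ : ∀ {q} s t → Period q (s ++ t) → Period q s
period-++ˡ {q} s t per i i+q<s = begin
  at s i              ≡⟨ at-++ˡ s t i<s ⟨
  at (s ++ t) i       ≡⟨ per i (<-≤-trans i+q<s (length-≤-++ s t)) ⟩
  at (s ++ t) (i + q) ≡⟨ at-++ˡ s t i+q<s ⟩
  at s (i + q)        ∎
  where
  open ≡-Reasoning
  i<s : i < length s
  i<s = ≤-<-trans (m≤m+n i q) i+q<s

-- Position i of s agrees with i + b in x, and so does i + (b − a), via period a.
period-∸ : ∀ {x a b} s t → s ++ t ≡ x → Period a x → Period b x → a ≤ b →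
           length s + a ≤ length x → Period (b ∸ a) s
period-∸ {x} {a} {b} s t refl per-a per-b a≤b s+a≤x i i+d<s = begin
  at s i                   ≡⟨ at-++ˡ s t i<s ⟨
  at x i                   ≡⟨ per-b i (subst (_< length x) i+d+a≡i+b i+d+a<x) ⟩
  at x (i + b)             ≡⟨ cong (at x) i+d+a≡i+b ⟨
  at x (i + (b ∸ a) + a)   ≡⟨ per-a (i + (b ∸ a)) i+d+a<x ⟨
  at x (i + (b ∸ a))       ≡⟨ at-++ˡ s t i+d<s ⟩
  at s (i + (b ∸ a))       ∎
  where
  open ≡-Reasoning
  i<s : i < length s
  i<s = ≤-<-trans (m≤m+n i (b ∸ a)) i+d<s
  i+d+a≡i+b : i + (b ∸ a) + a ≡ i + b
  i+d+a≡i+b = trans (+-assoc i (b ∸ a) a) (cong (i +_) (m∸n+n≡m a≤b))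
  i+d+a<x : i + (b ∸ a) + a < length x
  i+d+a<x = <-≤-trans (+-monoˡ-< a i+d<s) s+a≤x

border⇒period : ∀ {x} u v w → u ++ v ≡ x → w ++ u ≡ x → Period (length w) x
border⇒period u v w refl w++u≡x i i+w<x = begin
  at (u ++ v) i              ≡⟨ at-++ˡ u v i<u ⟩
  at u i                     ≡⟨ at-++ʳ w u i ⟨
  at (w ++ u) (length w + i) ≡⟨ cong₂ at w++u≡x (+-comm (length w) i) ⟩
  at (u ++ v) (i + length w) ∎
  where
  open ≡-Reasoning
  i<u : i < length u
  i<u = +-cancelˡ-< (length w) i (length u) (subst₂ _<_ (+-comm i (length w))
          (trans (cong length (sym w++u≡x)) (length-++ w)) i+w<x)

border-period-∸ : ∀ {x a} s t w → s ++ t ≡ x → w ++ s ≡ x → Period a x → a ≤ length w →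
                  Period (length w ∸ a) s
border-period-∸ {x} {a} s t w s++t≡x w++s≡x per a≤w =
  period-∸ s t s++t≡x per (border⇒period s t w s++t≡x w++s≡x) a≤w s+a≤x
  where
  s+a≤x : length s + a ≤ length x
  s+a≤x = subst (length s + a ≤_) (trans (+-comm (length s) (length w))
            (trans (sym (length-++ w)) (cong length w++s≡x))) (+-monoʳ-≤ (length s) a≤w)

take-length-++ : ∀ (xs ys : Str) → take (length xs) (xs ++ ys) ≡ xs
take-length-++ [] ys = refl
take-length-++ (c ∷ cs) ys = cong (c ∷_) (take-length-++ cs ys)

drop-length-++ : ∀ (xs ys : Str) → drop (length xs) (xs ++ ys) ≡ ys
drop-length-++ [] ys = refl
drop-length-++ (c ∷ cs) ys = drop-length-++ cs ys

occurs-prefix : ∀ u v → OccursAt u (u ++ v) 0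
occurs-prefix u v = length-≤-++ u v , take-length-++ u v

occurs-suffix : ∀ w u → OccursAt u (w ++ u) (length w)
occurs-suffix w u = ≤-reflexive (sym (length-++ w)) ,
  trans (cong (take (length u)) (drop-length-++ w u)) (take-all (length u) u ≤-refl)

occurs-at-0⇒prefix : ∀ {u x} → OccursAt u x 0 → ∃ λ v → u ++ v ≡ x
occurs-at-0⇒prefix {u} {x} (_ , u≡) =
  drop (length u) x , trans (cong (_++ drop (length u) x) (sym u≡)) (take++drop≡id (length u) x)

occurs-at-end⇒suffix : ∀ {u x j} → OccursAt u x j → length x ≤ j + length u →
                       ∃ λ w → w ++ u ≡ x
occurs-at-end⇒suffix {u} {x} {j} (_ , u≡) x≤j+u =
  take j x , trans (cong (take j x ++_) (sym drop≡u)) (take++drop≡id j x)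
  where
  drop≡u : drop j x ≡ u
  drop≡u = trans (sym (take-all (length u) (drop j x)
             (subst (_≤ length u) (sym (length-drop j x)) (m≤n+o⇒m∸n≤o (length x) j x≤j+u))))
             u≡

cover⇒prefix : ∀ {u x} → Cover u x → 0 < length x → ∃ λ v → u ++ v ≡ x
cover⇒prefix (_ , covers) 0<x with covers 0 0<x
... | j , occ , j≤0 , _ with n≤0⇒n≡0 j≤0
... | refl = occurs-at-0⇒prefix occ

cover⇒suffix : ∀ {u x} → Cover u x → 0 < length x → ∃ λ w → w ++ u ≡ x
cover⇒suffix {x = c ∷ cs} (_ , covers) _ with covers (length cs) ≤-refl
... | j , occ , _ , cs<j+u = occurs-at-end⇒suffix occ cs<j+u

border⇒cover : ∀ {x} u v w → u ++ v ≡ x → w ++ u ≡ x → length w ≤ length u → Cover u x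
border⇒cover u v w refl w++u≡x w≤u = (0 , occurs-prefix u v) , covers
  where
  occurs-w : OccursAt u (u ++ v) (length w)
  occurs-w = subst (λ x → OccursAt u x (length w)) w++u≡x (occurs-suffix w u)
  covers : (i : ℕ) → i < length (u ++ v) →
           ∃ λ j → OccursAt u (u ++ v) j × j ≤ i × i < j + length u
  covers i i<x with i <? length u
  ... | yes i<u = 0 , occurs-prefix u v , z≤n , i<u
  ... | no i≮u = length w , occurs-w , ≤-trans w≤u (≮⇒≥ i≮u) ,
                 subst (i <_) (trans (cong length (sym w++u≡x)) (length-++ w)) i<x

F-rec : ∀ n → F (2 + n) ≡ F (1 + n) + F n
F-rec n = length-++ (fib (1 + n))

1≤F : ∀ n → 1 ≤ F n
1≤F zero = s≤s z≤n
1≤F (suc zero) = s≤s z≤n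
1≤F (suc (suc n)) = subst (1 ≤_) (sym (F-rec n)) (≤-trans (1≤F (suc n)) (m≤m+n _ _))

2≤F : ∀ n → 2 ≤ F (2 + n)
2≤F n = subst (2 ≤_) (sym (F-rec n)) (+-mono-≤ (1≤F (1 + n)) (1≤F n))

F-< : ∀ n → F (2 + n) < F (3 + n)
F-< n = subst (F (2 + n) <_) (sym (F-rec (1 + n))) (m<m+n (F (2 + n)) (1≤F (1 + n)))

take-length-+-++ : ∀ (xs ys : Str) k → take (length xs + k) (xs ++ ys) ≡ xs ++ take k ys
take-length-+-++ [] ys k = refl
take-length-+-++ (c ∷ cs) ys k = cong (c ∷_) (take-length-+-++ cs ys k)

p-unfold : ∀ m → fib (3 + m) ++ p (2 + m) ≡ p (4 + m)
p-unfold m = sym (trans (cong (λ k → take k (fib (4 + m))) F∸2)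
                        (take-length-+-++ (fib (3 + m)) (fib (2 + m)) (F (2 + m) ∸ 2)))
  where
  F∸2 : F (4 + m) ∸ 2 ≡ F (3 + m) + (F (2 + m) ∸ 2)
  F∸2 = trans (cong (_∸ 2) (F-rec (2 + m))) (+-∸-assoc (F (3 + m)) (2≤F m))

p-prefix : ∀ m → ∃ λ t → p (3 + m) ++ t ≡ p (4 + m)
p-prefix m = drop (F (3 + m) ∸ 2) (fib (3 + m)) ++ p (2 + m) , (begin
  p (3 + m) ++ (drop (F (3 + m) ∸ 2) (fib (3 + m)) ++ p (2 + m))
    ≡⟨ ++-assoc (p (3 + m)) _ (p (2 + m)) ⟨
  (p (3 + m) ++ drop (F (3 + m) ∸ 2) (fib (3 + m))) ++ p (2 + m)
    ≡⟨ cong (_++ p (2 + m)) (take++drop≡id (F (3 + m) ∸ 2) (fib (3 + m))) ⟩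
  fib (3 + m) ++ p (2 + m)
    ≡⟨ p-unfold m ⟩
  p (4 + m) ∎)
  where open ≡-Reasoning

p-suffix : ∀ m → fib (2 + m) ++ p (3 + m) ≡ p (4 + m)
p-suffix zero = refl
p-suffix (suc m) = begin
  fib (3 + m) ++ p (4 + m)                  ≡⟨ cong (fib (3 + m) ++_) (p-suffix m) ⟨
  fib (3 + m) ++ (fib (2 + m) ++ p (3 + m)) ≡⟨ ++-assoc (fib (3 + m)) (fib (2 + m)) (p (3 + m)) ⟨
  fib (4 + m) ++ p (3 + m)                  ≡⟨ p-unfold (suc m) ⟩
  p (5 + m)                                 ∎
  where open ≡-Reasoning

length-p : ∀ m → F (2 + m) + length (p (3 + m)) ≡ length (p (4 + m))
length-p m = trans (sym (length-++ (fib (2 + m)))) (cong length (p-suffix m))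

p-short-period-free : ∀ k q → 0 < q → q < F (3 + k) → ¬ Period q (p (5 + k))
p-short-period-free zero 1 _ _ per with per 0 (s≤s (s≤s z≤n))
... | ()
p-short-period-free zero 2 _ _ per with per 1 (s≤s (s≤s (s≤s (s≤s z≤n))))
... | ()
p-short-period-free zero (suc (suc (suc q))) _ (s≤s (s≤s (s≤s ())))
p-short-period-free (suc k) q 0<q q<F per with p-prefix (2 + k) | q <? F (3 + k)
... | t , s++t≡x | yes q<F′ = p-short-period-free k q 0<q q<F′ (period-++ˡ (p (5 + k)) t
                                 (subst (Period q) (sym s++t≡x) per))
... | t , s++t≡x | no q≮F′ = p-short-period-free k (F (4 + k) ∸ q) (m<n⇒0<n∸m q<F) F∸q<F′
                                (border-period-∸ (p (5 + k)) t (fib (4 + k)) s++t≡x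
                                  (p-suffix (2 + k)) per (<⇒≤ q<F))
  where
  F∸q<F′ : F (4 + k) ∸ q < F (3 + k)
  F∸q<F′ = begin-strict
    F (4 + k) ∸ q             ≤⟨ ∸-monoʳ-≤ (F (4 + k)) (≮⇒≥ q≮F′) ⟩
    F (4 + k) ∸ F (3 + k)     ≡⟨ cong (_∸ F (3 + k)) (F-rec (2 + k)) ⟩
    F (3 + k) + F (2 + k) ∸ F (3 + k) ≡⟨ m+n∸m≡n (F (3 + k)) (F (2 + k)) ⟩
    F (2 + k)                 <⟨ F-< k ⟩
    F (3 + k)                 ∎
    where open ≤-Reasoning

proper-cover-length : ∀ k u → ProperCover u (p (5 + k)) → length u ≤ length (p (4 + k))
proper-cover-length k u (cover , u<x) with length u ≤? length (p (4 + k))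
... | yes u≤y = u≤y
... | no u≰y with cover⇒prefix cover 0<x | cover⇒suffix cover 0<x
  where
  0<x : 0 < length (p (5 + k))
  0<x = ≤-<-trans z≤n u<x
... | v , u++v≡x | w , w++u≡x = ⊥-elim (p-short-period-free k (length w) 0<w w<F
                                  (border⇒period u v w u++v≡x w++u≡x))
  where
  w+u≡x : length w + length u ≡ length (p (5 + k))
  w+u≡x = trans (sym (length-++ w)) (cong length w++u≡x)
  0<w : 0 < length w
  0<w = m+n≡o+q⇒q<n⇒m<o (sym w+u≡x) u<x
  w<F : length w < F (3 + k)
  w<F = m+n≡o+q⇒q<n⇒m<o (trans w+u≡x (sym (length-p (1 + k)))) (≰⇒> u≰y)

lemma12 : (n : ℕ) → 5 ≤ n →
    Border (p (n ∸ 1)) (p n) × ProperCover (p (n ∸ 1)) (p n) ×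
    ((u : Str) → ProperCover u (p n) → length u ≤ length (p (n ∸ 1)))
lemma12 (suc (suc (suc (suc (suc k))))) (s≤s (s≤s (s≤s (s≤s (s≤s z≤n))))) with p-prefix (1 + k)
... | t , y++t≡x =
  (0<y , y<x , (t , y++t≡x) , (fib (3 + k) , p-suffix (1 + k))) ,
  (border⇒cover (p (4 + k)) t (fib (3 + k)) y++t≡x (p-suffix (1 + k)) F≤y , y<x) ,
  proper-cover-length k
  where
  F≤y : F (3 + k) ≤ length (p (4 + k))
  F≤y = subst (F (3 + k) ≤_) (trans (sym (length-++ (fib (3 + k)))) (cong length (p-unfold k)))
          (m≤m+n (F (3 + k)) (length (p (2 + k))))
  0<y : 0 < length (p (4 + k))
  0<y = ≤-trans (1≤F (3 + k)) F≤y
  y<x : length (p (4 + k)) < length (p (5 + k))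
  y<x = subst (length (p (4 + k)) <_) (length-p (1 + k)) (m<n+m (length (p (4 + k))) (1≤F (3 + k)))
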